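{- Let $(G_n)_{n\in\mathbb{N}}$ be an iteratively constructible family. Then: (1) the families $(G_{\binom{n}{2}})_{n\in\mathbb{N}}$ and $(G_{n^2})_{n\in\mathbb{N}}$ are bi-iteratively constructible; (2) for all $c\in\mathbb{N}^{+}$ and $d,e\in\mathbb{Z}$ there exists $r\in\mathbb{N}$ such that the family $H_n=G_{cm^2+dm+e}$ with $m=n+r$, $n\in\mathbb{N}$, is bi-iteratively constructible.
   Context: A $k$-graph is $G=(V,E;R_1,\ldots,R_k)$ with $(V,E)$ a finite simple graph and labels $R_1,\ldots,R_k\subseteq V$ partitioning $V$. Basic operations on $k$-graphs: $Add_i$ (add a new vertex to $R_i$); $\rho_{i\to j}$ (move all vertices of $R_i$ into $R_j$, leaving $R_i$ empty); $\eta_{i,j}$ (add all edges between vertices labeled $i$ and vertices labeled $j$); $\eta^b_{i,j}$ (equal to $\eta_{i,j}$ if $|R_i\cup R_j|\leq b$, otherwise the identity); $\delta_{i,j}$ (remove all edges between vertices labeled $i$ and $j$). An elementary operation is a finite composition of basic operations. For a $k$-graph $G_0$ and elementary operation $F$, the $F$-iteration family is $G_{n+1}=F(G_n)$ (so $G_n=F^n(G_0)$); for elementary operations $H,F,L$, an $(H,F,L)$-bi-iteration family is given by $G_{n+1}=H(F^n(L(G_n)))$. A family of graphs is iteratively (resp. bi-iteratively) constructible if for some $k$ there is an iteration (resp. bi-iteration) family of $k$-graphs whose underlying graphs, ignoring labels, are the members of the family. -}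

module Defs where

open import Data.Nat using (ℕ; zero; suc; _+_; _*_; _≤_)
open import Data.Fin using (Fin; zero; suc)
open import Data.Fin.Properties using (_≟_)
open import Data.Bool using (Bool; true; false; if_then_else_; _∨_)
open import Data.Empty using (⊥)
open import Data.Product using (Σ; ∃; _×_; _,_; proj₁; proj₂)
open import Data.Sum using (_⊎_; inj₁; inj₂)
open import Data.List using (List; []; _∷_)
open import Function using (_∘_)
open import Function.Bundles using (_↔_; Inverse)
open import Relation.Nullary using (¬_; yes; no; does)
open import Relation.Nullary.Decidable using (⌊_⌋)
open import Relation.Binary.PropositionalEquality using (_≡_; _≢_; refl; sym)

record Graph : Set₁ where
  field
    size   : ℕ
    adj    : Fin size → Fin size → Set
    adj-sym    : ∀ u v → adj u v → adj v u
    adj-irrefl : ∀ u → ¬ adj u u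
open Graph public

record _≅_ (G H : Graph) : Set where
  field
    bij : Fin (size G) ↔ Fin (size H)
    preserves : ∀ u v → adj G u v → adj H (Inverse.to bij u) (Inverse.to bij v)
    reflects  : ∀ u v → adj H (Inverse.to bij u) (Inverse.to bij v) → adj G u v
open _≅_ public

-- k-graphs: a graph together with a labelling Fin size → Fin k
-- (R_i = vertices with label i; these partition V).

record KGraph (k : ℕ) : Set₁ where
  field
    graph : Graph
    label : Fin (size graph) → Fin k
open KGraph public

underlying : ∀ {k} → KGraph k → Graph
underlying = graph

addG : Graph → Graph
addG G = record { size = suc (size G) ; adj = a ; adj-sym = s ; adj-irrefl = ir }
  where
  a : Fin (suc (size G)) → Fin (suc (size G)) → Set
  a zero _ = ⊥
  a (suc _) zero = ⊥
  a (suc u) (suc v) = adj G u v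
  s : ∀ u v → a u v → a v u
  s zero _ ()
  s (suc u) zero ()
  s (suc u) (suc v) e = adj-sym G u v e
  ir : ∀ u → ¬ a u u
  ir zero ()
  ir (suc u) e = adj-irrefl G u e

Add : ∀ {k} → Fin k → KGraph k → KGraph k
Add {k} i G = record { graph = addG (graph G) ; label = l }
  where
  l : Fin (suc (size (graph G))) → Fin k
  l zero = i
  l (suc u) = label G u

Relabel : ∀ {k} → Fin k → Fin k → KGraph k → KGraph k
Relabel i j G = record { graph = graph G ; label = l }
  where
  l : _
  l u with label G u ≟ i
  ... | yes _ = j
  ... | no _ = label G u

Between : ∀ {k} (G : KGraph k) → Fin k → Fin k → Fin (size (graph G)) → Fin (size (graph G)) → Set
Between G i j u v = (label G u ≡ i × label G v ≡ j) ⊎ (label G u ≡ j × label G v ≡ i)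

Between-sym : ∀ {k} (G : KGraph k) i j {u v} → Between G i j u v → Between G i j v u
Between-sym G i j (inj₁ (p , q)) = inj₂ (q , p)
Between-sym G i j (inj₂ (p , q)) = inj₁ (q , p)

Join : ∀ {k} → Fin k → Fin k → KGraph k → KGraph k
Join i j G = record { graph = g ; label = label G }
  where
  Gr = graph G
  a : Fin (size Gr) → Fin (size Gr) → Set
  a u v = adj Gr u v ⊎ (u ≢ v × Between G i j u v)
  s : ∀ u v → a u v → a v u
  s u v (inj₁ e) = inj₁ (adj-sym Gr u v e)
  s u v (inj₂ (ne , b)) = inj₂ ((λ eq → ne (sym eq)) , Between-sym G i j b)
  ir : ∀ u → ¬ a u u
  ir u (inj₁ e) = adj-irrefl Gr u e
  ir u (inj₂ (ne , _)) = ne refl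
  g : Graph
  g = record { size = size Gr ; adj = a ; adj-sym = s ; adj-irrefl = ir }

Delete : ∀ {k} → Fin k → Fin k → KGraph k → KGraph k
Delete i j G = record { graph = g ; label = label G }
  where
  Gr = graph G
  a : Fin (size Gr) → Fin (size Gr) → Set
  a u v = adj Gr u v × ¬ Between G i j u v
  s : ∀ u v → a u v → a v u
  s u v (e , nb) = adj-sym Gr u v e , (λ b → nb (Between-sym G i j b))
  ir : ∀ u → ¬ a u u
  ir u (e , _) = adj-irrefl Gr u e
  g : Graph
  g = record { size = size Gr ; adj = a ; adj-sym = s ; adj-irrefl = ir }

count : ∀ {n} → (Fin n → Bool) → ℕ
count {zero} p = 0
count {suc n} p = (if p zero then 1 else 0) + count (p ∘ suc)

sizeUnion : ∀ {k} → KGraph k → Fin k → Fin k → ℕ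
sizeUnion G i j = count (λ u → ⌊ label G u ≟ i ⌋ ∨ ⌊ label G u ≟ j ⌋)

JoinBounded : ∀ {k} → ℕ → Fin k → Fin k → KGraph k → KGraph k
JoinBounded b i j G with sizeUnion G i j Data.Nat.≤? b
  where open import Data.Nat using (_≤?_)
... | yes _ = Join i j G
... | no _ = G

data BasicOp (k : ℕ) : Set where
  add      : Fin k → BasicOp k
  relabel  : Fin k → Fin k → BasicOp k
  join     : Fin k → Fin k → BasicOp k
  joinB    : ℕ → Fin k → Fin k → BasicOp k
  delete   : Fin k → Fin k → BasicOp k

applyBasic : ∀ {k} → BasicOp k → KGraph k → KGraph k
applyBasic (add i) = Add i
applyBasic (relabel i j) = Relabel i j
applyBasic (join i j) = Join i j
applyBasic (joinB b i j) = JoinBounded b i j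
applyBasic (delete i j) = Delete i j

-- Elementary operation: a finite composition of basic operations,
-- (o₁ ∷ o₂ ∷ … ∷ []) denotes o₁ ∘ o₂ ∘ … .
ElemOp : ℕ → Set
ElemOp k = List (BasicOp k)

apply : ∀ {k} → ElemOp k → KGraph k → KGraph k
apply [] G = G
apply (o ∷ os) G = applyBasic o (apply os G)

iter : ∀ {k} → ElemOp k → ℕ → KGraph k → KGraph k
iter F zero G = G
iter F (suc n) G = apply F (iter F n G)

biIter : ∀ {k} → ElemOp k → ElemOp k → ElemOp k → KGraph k → ℕ → KGraph k
biIter H F L G₀ zero = G₀
biIter H F L G₀ (suc n) = apply H (iter F n (apply L (biIter H F L G₀ n)))

IterConstructible : (ℕ → Graph) → Set₁
IterConstructible Gs =
  Σ ℕ λ k → Σ (KGraph k) λ G₀ → Σ (ElemOp k) λ F →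
    ∀ n → underlying (iter F n G₀) ≅ Gs n

BiIterConstructible : (ℕ → Graph) → Set₁
BiIterConstructible Gs =
  Σ ℕ λ k → Σ (KGraph k) λ G₀ → Σ (ElemOp k) λ H → Σ (ElemOp k) λ F → Σ (ElemOp k) λ L →
    ∀ n → underlying (biIter H F L G₀ n) ≅ Gs n

-- Iterating F a fixed number of times is again an elementary operation, so a
-- bi-iteration H = F^a, F' = F^j, L = id, started from F^(Q 0) G₀, produces
-- F^(Q n) G₀ at stage n whenever Q(n+1) = Q n + j n + a.  Both n(n-1)/2 and n²
-- satisfy such a recurrence.  So does c m² + d m + e along m = n + r, with
-- a = c(2r+1) + d and j = 2c; for r beyond the negative parts of d and e the
-- initial value and a are natural numbers, and the index sequence is then
-- defined by the recurrence itself.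
module Submission where

open import Defs
open import Data.Nat using (ℕ; zero; suc; _+_; _*_; _≤_)
open import Data.Nat.Combinatorics using (_C_; nC1≡n; nCk+nC[k+1]≡[n+1]C[k+1])
open import Data.Nat.Properties using (*-identityʳ)
open import Data.Integer using (ℤ; +_; -[1+_])
import Data.Integer as ℤ
open import Data.Integer.Properties using (pos-*; +-identityʳ)
import Data.Nat.Tactic.RingSolver as ℕ-Solver
import Data.Integer.Tactic.RingSolver as ℤ-Solver
open import Data.Product using (Σ; ∃; _×_; _,_)
open import Data.List using ([]; _∷_; _++_)
open import Relation.Binary.PropositionalEquality
  using (_≡_; refl; sym; trans; cong; cong₂; subst; module ≡-Reasoning)
open ≡-Reasoning

module _ {k : ℕ} where

  repeat : ℕ → ElemOp k → ElemOp k
  repeat zero    F = []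
  repeat (suc a) F = F ++ repeat a F

  apply-++ : ∀ (F F′ : ElemOp k) G → apply (F ++ F′) G ≡ apply F (apply F′ G)
  apply-++ []      F′ G = refl
  apply-++ (o ∷ F) F′ G = cong (applyBasic o) (apply-++ F F′ G)

  apply-repeat : ∀ a (F : ElemOp k) G → apply (repeat a F) G ≡ iter F a G
  apply-repeat zero    F G = refl
  apply-repeat (suc a) F G =
    trans (apply-++ F (repeat a F) G) (cong (apply F) (apply-repeat a F G))

  iter-+ : ∀ (F : ElemOp k) a b G → iter F a (iter F b G) ≡ iter F (a + b) G
  iter-+ F zero    b G = refl
  iter-+ F (suc a) b G = cong (apply F) (iter-+ F a b G)

  iter-repeat : ∀ j (F : ElemOp k) n G → iter (repeat j F) n G ≡ iter F (n * j) G
  iter-repeat j F zero    G = refl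
  iter-repeat j F (suc n) G = begin
    apply (repeat j F) (iter (repeat j F) n G) ≡⟨ apply-repeat j F _ ⟩
    iter F j (iter (repeat j F) n G)           ≡⟨ cong (iter F j) (iter-repeat j F n G) ⟩
    iter F j (iter F (n * j) G)                ≡⟨ iter-+ F j (n * j) G ⟩
    iter F (j + n * j) G                       ∎

  biIter-repeat : ∀ (F : ElemOp k) G₀ (Q : ℕ → ℕ) a j →
    (∀ n → Q (suc n) ≡ a + (n * j + Q n)) →
    ∀ n → biIter (repeat a F) (repeat j F) [] (iter F (Q 0) G₀) n ≡ iter F (Q n) G₀
  biIter-repeat F G₀ Q a j Q-suc zero    = refl
  biIter-repeat F G₀ Q a j Q-suc (suc n) = begin
    apply (repeat a F) (iter (repeat j F) n (biIter H F′ [] G₀′ n))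
      ≡⟨ apply-repeat a F _ ⟩
    iter F a (iter (repeat j F) n (biIter H F′ [] G₀′ n))
      ≡⟨ cong (iter F a) (iter-repeat j F n _) ⟩
    iter F a (iter F (n * j) (biIter H F′ [] G₀′ n))
      ≡⟨ cong (λ X → iter F a (iter F (n * j) X)) (biIter-repeat F G₀ Q a j Q-suc n) ⟩
    iter F a (iter F (n * j) (iter F (Q n) G₀))
      ≡⟨ cong (iter F a) (iter-+ F (n * j) (Q n) G₀) ⟩
    iter F a (iter F (n * j + Q n) G₀)
      ≡⟨ iter-+ F a (n * j + Q n) G₀ ⟩
    iter F (a + (n * j + Q n)) G₀
      ≡⟨ cong (λ m → iter F m G₀) (sym (Q-suc n)) ⟩
    iter F (Q (suc n)) G₀
      ∎
    where
    H F′ : ElemOp k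
    H = repeat a F
    F′ = repeat j F
    G₀′ : KGraph k
    G₀′ = iter F (Q 0) G₀

reindex-biIterConstructible : ∀ {Gs} → IterConstructible Gs →
  ∀ (Q : ℕ → ℕ) a j → (∀ n → Q (suc n) ≡ a + (n * j + Q n)) →
  BiIterConstructible (λ n → Gs (Q n))
reindex-biIterConstructible {Gs} (k , G₀ , F , G≅) Q a j Q-suc =
  k , iter F (Q 0) G₀ , repeat a F , repeat j F , [] , λ n →
    subst (λ X → underlying X ≅ Gs (Q n)) (sym (biIter-repeat F G₀ Q a j Q-suc n)) (G≅ (Q n))

[1+n]C2 : ∀ n → suc n C 2 ≡ 0 + (n * 1 + n C 2)
[1+n]C2 n = begin
  suc n C 2      ≡⟨ sym (nCk+nC[k+1]≡[n+1]C[k+1] n 1) ⟩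
  n C 1 + n C 2  ≡⟨ cong (_+ n C 2) (trans (nC1≡n n) (sym (*-identityʳ n))) ⟩
  n * 1 + n C 2  ∎

[1+n]² : ∀ n → (1 + n) * (1 + n) ≡ 1 + (n * 2 + n * n)
[1+n]² = ℕ-Solver.solve-∀

quadratic : ℤ → ℤ → ℤ → ℤ → ℤ
quadratic c d e m = c ℤ.* m ℤ.* m ℤ.+ d ℤ.* m ℤ.+ e

quadratic-suc : ∀ c d e n r →
  quadratic c d e (+ 1 ℤ.+ (n ℤ.+ r))
    ≡ (c ℤ.* (r ℤ.+ r ℤ.+ + 1) ℤ.+ d) ℤ.+ (n ℤ.* (c ℤ.+ c) ℤ.+ quadratic c d e (n ℤ.+ r))
quadratic-suc c d e n r = solve c d e n r
  where
  -- solve-∀ cannot see through the definition of quadratic.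
  solve : ∀ c d e n r → let m = n ℤ.+ r in
    c ℤ.* (+ 1 ℤ.+ m) ℤ.* (+ 1 ℤ.+ m) ℤ.+ d ℤ.* (+ 1 ℤ.+ m) ℤ.+ e
      ≡ (c ℤ.* (r ℤ.+ r ℤ.+ + 1) ℤ.+ d) ℤ.+ (n ℤ.* (c ℤ.+ c) ℤ.+ (c ℤ.* m ℤ.* m ℤ.+ d ℤ.* m ℤ.+ e))
  solve = ℤ-Solver.solve-∀

quadraticSeq : ℕ → ℕ → ℕ → ℕ → ℕ
quadraticSeq a j q₀ zero    = q₀
quadraticSeq a j q₀ (suc n) = a + (n * j + quadraticSeq a j q₀ n)

-- ℕ-addition under +_ is definitionally ℤ-addition, so only products need casting.
quadraticSeq-≡ : ∀ c d e r {a q₀} →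
  + a ≡ + c ℤ.* (+ r ℤ.+ + r ℤ.+ + 1) ℤ.+ d → + q₀ ≡ quadratic (+ c) d e (+ r) →
  ∀ n → + quadraticSeq a (c + c) q₀ n ≡ quadratic (+ c) d e (+ (n + r))
quadraticSeq-≡ c d e r a≡ q₀≡ zero    = q₀≡
quadraticSeq-≡ c d e r {a} {q₀} a≡ q₀≡ (suc n) = begin
  + a ℤ.+ (+ (n * (c + c)) ℤ.+ + Q n)
    ≡⟨ cong₂ (λ x y → x ℤ.+ (y ℤ.+ + Q n)) a≡ (pos-* n (c + c)) ⟩
  slope ℤ.+ (+ n ℤ.* (+ c ℤ.+ + c) ℤ.+ + Q n)
    ≡⟨ cong (λ y → slope ℤ.+ (+ n ℤ.* (+ c ℤ.+ + c) ℤ.+ y)) (quadraticSeq-≡ c d e r a≡ q₀≡ n) ⟩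
  slope ℤ.+ (+ n ℤ.* (+ c ℤ.+ + c) ℤ.+ f (+ n ℤ.+ + r))
    ≡⟨ sym (quadratic-suc (+ c) d e (+ n) (+ r)) ⟩
  f (+ (suc n + r))
    ∎
  where
  Q : ℕ → ℕ
  Q = quadraticSeq a (c + c) q₀
  f : ℤ → ℤ
  f = quadratic (+ c) d e
  slope : ℤ
  slope = + c ℤ.* (+ r ℤ.+ + r ℤ.+ + 1) ℤ.+ d

positivePart negativePart : ℤ → ℕ
positivePart (+ n)    = n
positivePart -[1+ n ] = 0
negativePart (+ n)    = 0
negativePart -[1+ n ] = suc n

positivePart-negativePart : ∀ i → + positivePart i ℤ.- + negativePart i ≡ i
positivePart-negativePart (+ n)    = +-identityʳ (+ n)
positivePart-negativePart -[1+ n ] = refl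

offset : ℤ → ℤ → ℕ
offset d e = suc (negativePart d + negativePart e)

module _ (c′ : ℕ) (d e : ℤ) where
  private
    P D P′ E r : ℕ
    P = positivePart d
    D = negativePart d
    P′ = positivePart e
    E = negativePart e
    r = offset d e

  -- c (2r+1) + d = c′ (2r+1) + (2r+1 − D) + P, and 2r+1 − D = 3 + D + 2E.
  slope-natural : ∃ λ a → + a ≡ + suc c′ ℤ.* (+ r ℤ.+ + r ℤ.+ + 1) ℤ.+ d
  slope-natural = c′ * (r + r + 1) + (3 + D + E + E + P) , (begin
    + (c′ * (r + r + 1)) ℤ.+ + (3 + D + E + E + P)
      ≡⟨ cong (ℤ._+ + (3 + D + E + E + P)) (pos-* c′ (r + r + 1)) ⟩
    + c′ ℤ.* (+ r ℤ.+ + r ℤ.+ + 1) ℤ.+ (+ 3 ℤ.+ + D ℤ.+ + E ℤ.+ + E ℤ.+ + P)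
      ≡⟨ solve (+ c′) (+ D) (+ E) (+ P) ⟩
    + suc c′ ℤ.* (+ r ℤ.+ + r ℤ.+ + 1) ℤ.+ (+ P ℤ.- + D)
      ≡⟨ cong (ℤ._+_ (+ suc c′ ℤ.* (+ r ℤ.+ + r ℤ.+ + 1))) (positivePart-negativePart d) ⟩
    + suc c′ ℤ.* (+ r ℤ.+ + r ℤ.+ + 1) ℤ.+ d
      ∎)
    where
    solve : ∀ c′ D E P → let R = + 1 ℤ.+ (D ℤ.+ E) in
      c′ ℤ.* (R ℤ.+ R ℤ.+ + 1) ℤ.+ (+ 3 ℤ.+ D ℤ.+ E ℤ.+ E ℤ.+ P)
        ≡ (+ 1 ℤ.+ c′) ℤ.* (R ℤ.+ R ℤ.+ + 1) ℤ.+ (P ℤ.- D)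
    solve = ℤ-Solver.solve-∀

  -- c r² + d r + e = c′ r² + r (r − D) − E + P r + P′, and r (r − D) − E = (D + E) E + r.
  initial-natural : ∃ λ q₀ → + q₀ ≡ quadratic (+ suc c′) d e (+ r)
  initial-natural = c′ * r * r + (D + E) * E + r + P * r + P′ , (begin
    + (c′ * r * r) ℤ.+ + ((D + E) * E) ℤ.+ + r ℤ.+ + (P * r) ℤ.+ + P′
      ≡⟨ cong₂ (λ x y → x ℤ.+ y ℤ.+ + P′) (cong₂ (λ x y → x ℤ.+ y ℤ.+ + r)
           (trans (pos-* (c′ * r) r) (cong (ℤ._* + r) (pos-* c′ r))) (pos-* (D + E) E))
           (pos-* P r) ⟩
    + c′ ℤ.* + r ℤ.* + r ℤ.+ (+ D ℤ.+ + E) ℤ.* + E ℤ.+ + r ℤ.+ + P ℤ.* + r ℤ.+ + P′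
      ≡⟨ solve (+ c′) (+ D) (+ E) (+ P) (+ P′) ⟩
    quadratic (+ suc c′) (+ P ℤ.- + D) (+ P′ ℤ.- + E) (+ r)
      ≡⟨ cong₂ (λ d e → quadratic (+ suc c′) d e (+ r))
           (positivePart-negativePart d) (positivePart-negativePart e) ⟩
    quadratic (+ suc c′) d e (+ r)
      ∎)
    where
    solve : ∀ c′ D E P P′ → let R = + 1 ℤ.+ (D ℤ.+ E) in
      c′ ℤ.* R ℤ.* R ℤ.+ (D ℤ.+ E) ℤ.* E ℤ.+ R ℤ.+ P ℤ.* R ℤ.+ P′
        ≡ (+ 1 ℤ.+ c′) ℤ.* R ℤ.* R ℤ.+ (P ℤ.- D) ℤ.* R ℤ.+ (P′ ℤ.- E)
    solve = ℤ-Solver.solve-∀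

lemma5p11 : (Gs : ℕ → Graph) → IterConstructible Gs →
    (BiIterConstructible (λ n → Gs (n C 2)) × BiIterConstructible (λ n → Gs (n * n)))
    × ((c : ℕ) → 1 ≤ c → (d e : ℤ) →
        Σ ℕ λ r → Σ (ℕ → ℕ) λ idx →
          ((n : ℕ) → + idx n ≡ (+ c) ℤ.* (+ (n + r)) ℤ.* (+ (n + r))
                                ℤ.+ d ℤ.* (+ (n + r)) ℤ.+ e)
          × BiIterConstructible (λ n → Gs (idx n)))
lemma5p11 Gs G-iter =
  ( reindex-biIterConstructible G-iter (_C 2) 0 1 [1+n]C2
  , reindex-biIterConstructible G-iter (λ n → n * n) 1 2 [1+n]² )
  , λ { (suc c′) _ d e →
        let a , a≡ = slope-natural c′ d e
            q₀ , q₀≡ = initial-natural c′ d e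
            j = suc c′ + suc c′
        in offset d e , quadraticSeq a j q₀ , quadraticSeq-≡ (suc c′) d e (offset d e) a≡ q₀≡
         , reindex-biIterConstructible G-iter (quadraticSeq a j q₀) a j (λ _ → refl) }
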